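{- Let $k\ge 1$. If $m$ is a positive integer with \[ m\equiv \sum_{i=0}^{k+1}4^i+2\cdot 4^k \pmod{2\cdot 4^{k+1}}, \] then $m\equiv 5\pmod 8$ and the triple $(m,S(m),S^2(m))$ has permutation pattern $(3,1,2)$, i.e. $S(m)<S^2(m)<m$.
   Context: The Syracuse function $S$ on odd positive integers is defined by $S(m)=(3m+1)/2^e$, where $e$ is the largest integer with $2^e\mid 3m+1$. For a triple $(x_1,x_2,x_3)$ of distinct reals with coordinates in increasing order $y_1<y_2<y_3$, its permutation pattern is the permutation $\sigma$ of $\{1,2,3\}$ with $x_i=y_{\sigma(i)}$, written $(\sigma(1),\sigma(2),\sigma(3))$. -}

module Defs where

open import Data.Nat using (ℕ; zero; suc; _+_; _*_; _^_; _<_; _≤?_)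
open import Data.Nat.DivMod using (_%_; _/_)
open import Data.Fin using (Fin)
open import Data.Product using (_×_; _,_)
open import Relation.Nullary using (yes; no)
open import Relation.Binary.PropositionalEquality using (_≢_)

sumTo : ℕ → (ℕ → ℕ) → ℕ
sumTo zero f = f 0
sumTo (suc n) f = sumTo n f + f (suc n)

-- odd part of n: divide by 2 while even (fuel-bounded; fuel ≥ n suffices,
-- since each halving step reduces the positive value)
oddPartFuel : ℕ → ℕ → ℕ
oddPartFuel zero n = n
oddPartFuel (suc fuel) n with n % 2
... | zero = oddPartFuel fuel (n / 2)
... | suc _ = n

oddPart : ℕ → ℕ
oddPart n = oddPartFuel n n

S : ℕ → ℕ
S m = oddPart (3 * m + 1)

below : ℕ → ℕ → ℕ
below a b with b ≤? a
... | yes _ = 0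
... | no _ = 1

rank : ℕ → ℕ → ℕ → ℕ
rank x y z = suc (below y x + below z x)

pattern3 : ℕ → ℕ → ℕ → ℕ × ℕ × ℕ
pattern3 x₁ x₂ x₃ = rank x₁ x₂ x₃ , rank x₂ x₁ x₃ , rank x₃ x₁ x₂

Distinct3 : ℕ → ℕ → ℕ → Set
Distinct3 a b c = (a ≢ b) × (a ≢ c) × (b ≢ c)

-- With X = 4^k, the geometric sum s = Σ_{i≤k+1} 4^i satisfies 3s + 1 = 16X, so for
-- m = s + 2X + 8qX we get 3m + 1 = 2X · (11 + 12q). Hence S(m) = 11 + 12q, and then
-- 3 S(m) + 1 = 2 · (17 + 18q) gives S²(m) = 17 + 18q. For k ≥ 1, 3m + 1 ≥ 8 (11 + 12q)
-- puts m above S²(m), and s ≡ 5 (mod 16) while the other two terms vanish mod 8.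
module Submission where

open import Defs
open import Data.Nat using (ℕ; zero; suc; _+_; _*_; _^_; _<_; _≤_; _∸_; z<s; _/_)
open import Data.Nat.DivMod using (_%_; [m+kn]%n≡m%n; m*n%n≡0; m*n/n≡m)
open import Data.Nat.Properties
open import Data.Nat.Tactic.RingSolver using (solve-∀)
open import Data.Product using (_×_; _,_; ∃)
open import Relation.Binary.PropositionalEquality
open import Relation.Nullary using (yes; no)
open import Relation.Nullary.Negation using (contradiction)

suc-m+n≡o⇒m<o : ∀ {a b} c → suc a + c ≡ b → a < b
suc-m+n≡o⇒m<o {a} c eq = subst (a <_) eq (m≤m+n (suc a) c)

n<2^n : ∀ n → n < 2 ^ n
n<2^n zero = z<s
n<2^n (suc n) = subst (_< 2 ^ suc n) (+-comm n 1)
  (+-mono-<-≤ (n<2^n n) (subst (1 ≤_) (sym (+-identityʳ (2 ^ n))) (m^n>0 2 n)))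

oddPartFuel-odd : ∀ fuel t → oddPartFuel fuel (1 + t * 2) ≡ 1 + t * 2
oddPartFuel-odd zero t = refl
oddPartFuel-odd (suc fuel) t with (1 + t * 2) % 2 in odd
... | zero = contradiction (trans (sym odd) ([m+kn]%n≡m%n 1 t 2)) 0≢1+n
... | suc _ = refl

2^suc*n≡2^*n*2 : ∀ j n → 2 ^ suc j * n ≡ 2 ^ j * n * 2
2^suc*n≡2^*n*2 j n = trans (*-assoc 2 (2 ^ j) n) (*-comm 2 (2 ^ j * n))

2^suc*n%2≡0 : ∀ j n → 2 ^ suc j * n % 2 ≡ 0
2^suc*n%2≡0 j n = trans (cong (_% 2) (2^suc*n≡2^*n*2 j n)) (m*n%n≡0 (2 ^ j * n) 2)

2^suc*n/2≡2^*n : ∀ j n → 2 ^ suc j * n / 2 ≡ 2 ^ j * n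
2^suc*n/2≡2^*n j n = trans (cong (_/ 2) (2^suc*n≡2^*n*2 j n)) (m*n/n≡m (2 ^ j * n) 2)

oddPartFuel-2^j*odd : ∀ j fuel t → oddPartFuel (j + fuel) (2 ^ j * (1 + t * 2)) ≡ 1 + t * 2
oddPartFuel-2^j*odd zero fuel t rewrite *-identityˡ (1 + t * 2) = oddPartFuel-odd fuel t
oddPartFuel-2^j*odd (suc j) fuel t with 2 ^ suc j * (1 + t * 2) % 2 in parity
... | zero rewrite 2^suc*n/2≡2^*n j (1 + t * 2) = oddPartFuel-2^j*odd j fuel t
... | suc _ = contradiction (trans (sym parity) (2^suc*n%2≡0 j (1 + t * 2))) 1+n≢0

oddPart-2^j*odd : ∀ j t → oddPart (2 ^ j * (1 + t * 2)) ≡ 1 + t * 2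
oddPart-2^j*odd j t = subst (λ fuel → oddPartFuel fuel n ≡ 1 + t * 2)
  (m+[n∸m]≡n j≤n) (oddPartFuel-2^j*odd j (n ∸ j) t)
  where
  n = 2 ^ j * (1 + t * 2)
  j≤n : j ≤ n
  j≤n = ≤-trans (<⇒≤ (n<2^n j)) (m≤m*n (2 ^ j) (1 + t * 2))

S-of-3m+1≡2^j*odd : ∀ m j t → 3 * m + 1 ≡ 2 ^ j * (1 + t * 2) → S m ≡ 1 + t * 2
S-of-3m+1≡2^j*odd m j t eq rewrite eq = oddPart-2^j*odd j t
3*Σ4^i+1≡4^suc : ∀ n → 3 * sumTo n (λ i → 4 ^ i) + 1 ≡ 4 ^ suc n
3*Σ4^i+1≡4^suc zero = refl
3*Σ4^i+1≡4^suc (suc n) = begin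
  3 * (s + 4 ^ suc n) + 1   ≡⟨ distrib s (4 ^ suc n) ⟩
  (3 * s + 1) + 3 * 4 ^ suc n ≡⟨ cong (_+ 3 * 4 ^ suc n) (3*Σ4^i+1≡4^suc n) ⟩
  4 ^ suc n + 3 * 4 ^ suc n ∎
  where
  open ≡-Reasoning
  s = sumTo n (λ i → 4 ^ i)
  distrib : ∀ a b → 3 * (a + b) + 1 ≡ (3 * a + 1) + 3 * b
  distrib = solve-∀

Σ4^i≡5+t*16 : ∀ n → ∃ λ t → sumTo (suc n) (λ i → 4 ^ i) ≡ 5 + t * 16
Σ4^i≡5+t*16 zero = 0 , refl
Σ4^i≡5+t*16 (suc n) with Σ4^i≡5+t*16 n
... | t , eq = t + 4 ^ n , trans (cong (_+ 4 ^ suc (suc n)) eq) (regroup t (4 ^ n))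
  where
  regroup : ∀ t x → 5 + t * 16 + 4 * (4 * x) ≡ 5 + (t + x) * 16
  regroup = solve-∀

seed : ℕ → ℕ → ℕ
seed k q = sumTo (suc k) (λ i → 4 ^ i) + 2 * 4 ^ k + q * (2 * 4 ^ suc k)

3*seed+1≡ : ∀ k q → 3 * seed k q + 1 ≡ 2 * 4 ^ k * (1 + (5 + 6 * q) * 2)
3*seed+1≡ k q = begin
  3 * (s + 2 * X + q * (2 * (4 * X))) + 1      ≡⟨ expand s X q ⟩
  (3 * s + 1) + (6 * X + 24 * q * X)            ≡⟨ cong (_+ (6 * X + 24 * q * X)) (3*Σ4^i+1≡4^suc (suc k)) ⟩
  4 * (4 * X) + (6 * X + 24 * q * X)            ≡⟨ factor X q ⟩
  2 * X * (1 + (5 + 6 * q) * 2)                 ∎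
  where
  open ≡-Reasoning
  s = sumTo (suc k) (λ i → 4 ^ i)
  X = 4 ^ k
  expand : ∀ s X q → 3 * (s + 2 * X + q * (2 * (4 * X))) + 1 ≡ (3 * s + 1) + (6 * X + 24 * q * X)
  expand = solve-∀
  factor : ∀ X q → 4 * (4 * X) + (6 * X + 24 * q * X) ≡ 2 * X * (1 + (5 + 6 * q) * 2)
  factor = solve-∀

S-seed : ∀ k q → S (seed k q) ≡ 1 + (5 + 6 * q) * 2
S-seed k q = S-of-3m+1≡2^j*odd (seed k q) (suc (2 * k)) (5 + 6 * q)
  -- 4 ^ k and (2 ^ 2) ^ k are definitionally equal
  (trans (3*seed+1≡ k q) (cong (λ x → 2 * x * (1 + (5 + 6 * q) * 2)) (^-*-assoc 2 2 k)))

S²-seed : ∀ k q → S (S (seed k q)) ≡ 1 + (8 + 9 * q) * 2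
S²-seed k q = trans (cong S (S-seed k q))
  (S-of-3m+1≡2^j*odd (1 + (5 + 6 * q) * 2) 1 (8 + 9 * q) (step q))
  where
  step : ∀ q → 3 * (1 + (5 + 6 * q) * 2) + 1 ≡ 2 ^ 1 * (1 + (8 + 9 * q) * 2)
  step = solve-∀

S-seed<S²-seed : ∀ k q → S (seed k q) < S (S (seed k q))
S-seed<S²-seed k q = subst₂ _<_ (sym (S-seed k q)) (sym (S²-seed k q)) (suc-m+n≡o⇒m<o (5 + 6 * q) (gap q))
  where
  gap : ∀ q → suc (1 + (5 + 6 * q) * 2) + (5 + 6 * q) ≡ 1 + (8 + 9 * q) * 2
  gap = solve-∀

3*m+1<3*n+1⇒m<n : ∀ {m n} → 3 * m + 1 < 3 * n + 1 → m < n
3*m+1<3*n+1⇒m<n {m} {n} lt = *-cancelˡ-< 3 m n (+-cancelʳ-< 1 (3 * m) (3 * n) lt)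

S²-seed<seed : ∀ k q → S (S (seed (suc k) q)) < seed (suc k) q
S²-seed<seed k q = subst (_< seed (suc k) q) (sym (S²-seed (suc k) q)) (3*m+1<3*n+1⇒m<n (begin-strict
  3 * o₂ + 1                        <⟨ suc-m+n≡o⇒m<o (35 + 42 * q) (gap q) ⟩
  8 * o₁                            ≤⟨ *-monoˡ-≤ o₁ (*-monoʳ-≤ 2 (*-monoʳ-≤ 4 (m^n>0 4 k))) ⟩
  2 * 4 ^ suc k * o₁                ≡⟨ 3*seed+1≡ (suc k) q ⟨
  3 * seed (suc k) q + 1            ∎))
  where
  open ≤-Reasoning
  o₁ = 1 + (5 + 6 * q) * 2
  o₂ = 1 + (8 + 9 * q) * 2
  gap : ∀ q → suc (3 * (1 + (8 + 9 * q) * 2) + 1) + (35 + 42 * q) ≡ 8 * (1 + (5 + 6 * q) * 2)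
  gap = solve-∀

seed≡5+r*8 : ∀ k q t → sumTo (suc (suc k)) (λ i → 4 ^ i) ≡ 5 + t * 16 →
  seed (suc k) q ≡ 5 + (2 * t + 4 ^ k + 4 * q * 4 ^ k) * 8
seed≡5+r*8 k q t eq = begin
  s + 2 * (4 * X) + q * (2 * (4 * (4 * X)))          ≡⟨ cong (λ s → s + 2 * (4 * X) + q * (2 * (4 * (4 * X)))) eq ⟩
  5 + t * 16 + 2 * (4 * X) + q * (2 * (4 * (4 * X))) ≡⟨ regroup t X q ⟩
  5 + (2 * t + X + 4 * q * X) * 8                    ∎
  where
  open ≡-Reasoning
  s = sumTo (suc (suc k)) (λ i → 4 ^ i)
  X = 4 ^ k
  regroup : ∀ t X q → 5 + t * 16 + 2 * (4 * X) + q * (2 * (4 * (4 * X))) ≡ 5 + (2 * t + X + 4 * q * X) * 8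
  regroup = solve-∀

seed%8≡5 : ∀ k q → seed (suc k) q % 8 ≡ 5
seed%8≡5 k q =
  let t , eq = Σ4^i≡5+t*16 (suc k)
  in trans (cong (_% 8) (seed≡5+r*8 k q t eq)) ([m+kn]%n≡m%n 5 (2 * t + 4 ^ k + 4 * q * 4 ^ k) 8)

below-< : ∀ {a b} → a < b → below a b ≡ 1
below-< {a} {b} a<b with b ≤? a
... | yes b≤a = contradiction b≤a (<⇒≱ a<b)
... | no _ = refl

below-≥ : ∀ {a b} → b ≤ a → below a b ≡ 0
below-≥ {a} {b} b≤a with b ≤? a
... | yes _ = refl
... | no b≰a = contradiction b≤a b≰a

pattern3-312 : ∀ {a b c} → b < c → c < a → pattern3 a b c ≡ (3 , 1 , 2)
pattern3-312 b<c c<a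
  rewrite below-< (<-trans b<c c<a) | below-< c<a
        | below-≥ (<⇒≤ (<-trans b<c c<a)) | below-≥ (<⇒≤ b<c)
        | below-≥ (<⇒≤ c<a) | below-< b<c = refl

distinct3 : ∀ {a b c} → b < c → c < a → Distinct3 a b c
distinct3 b<c c<a = ≢-sym (<⇒≢ (<-trans b<c c<a)) , ≢-sym (<⇒≢ c<a) , <⇒≢ b<c

mainTheorem7 : ∀ (k m : ℕ) → 1 ≤ k → 1 ≤ m →
    ∃ (λ q → m ≡ sumTo (suc k) (λ i → 4 ^ i) + 2 * 4 ^ k + q * (2 * 4 ^ (suc k))) →
    (m % 8 ≡ 5) × Distinct3 m (S m) (S (S m)) × (pattern3 m (S m) (S (S m)) ≡ (3 , 1 , 2))
      × (S m < S (S m)) × (S (S m) < m)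
mainTheorem7 (suc k) _ _ _ (q , refl) =
  seed%8≡5 k q , distinct3 S<S² S²<m , pattern3-312 S<S² S²<m , S<S² , S²<m
  where
  S<S² : S (seed (suc k) q) < S (S (seed (suc k) q))
  S<S² = S-seed<S²-seed (suc k) q
  S²<m : S (S (seed (suc k) q)) < seed (suc k) q
  S²<m = S²-seed<seed k q
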